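{- Let $G=(V,E)$ and the algorithm be as described in the context, executed under the distributed adversarial daemon. If in some step of an execution a process $i$ executes an Update move which sets $m_i$ to true, then $i$ makes no further move in the rest of the execution.
   Context: Let $G=(V,E)$ be a finite simple undirected graph; each node is a process and $N(i)$ denotes the set of neighbours of $i$. Each process has an identifier from a totally ordered set; identifiers of any two distinct processes at distance at most $2$ are distinct, and comparisons such as $j>i$ between processes are comparisons of their identifiers. Each process $i$ holds variables $m_i\in\{\text{true},\text{false}\}$ and $p_i\in\{null\}\cup N(i)$; a configuration is an assignment of values to all these variables. Define the predicate $PRmarried(i)\equiv \exists j\in N(i): (p_i=j \text{ and } p_j=i)$. The algorithm consists of the following four guarded rules for each process $i$ (a rule is enabled at $i$ if its guard holds; at most one rule is enabled at a process at any time): Update: if $m_i\neq PRmarried(i)$ then $m_i:=PRmarried(i)$. Marriage: if $m_i=PRmarried(i)$ and $p_i=null$ and there is $j\in N(i)$ with $p_j=i$, then $p_i:=j$ (for such a $j$). Seduction: if $m_i=PRmarried(i)$ and $p_i=null$ and $p_k\neq i$ for all $k\in N(i)$ and there is $j\in N(i)$ with $p_j=null$, $j>i$ and $m_j=\text{false}$, then $p_i:=\max\{j\in N(i): p_j=null,\ j>i,\ m_j=\text{false}\}$. Abandonment: if $m_i=PRmarried(i)$ and $p_i=j\neq null$ and $p_j\neq i$ and ($m_j=\text{true}$ or $j\le i$), then $p_i:=null$. A process is eligible if some rule is enabled at it. Under the distributed adversarial daemon, a step from a configuration $C$ consists of an arbitrary nonempty subset of the processes eligible in $C$ each executing its enabled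 rule, all guards and assignments being evaluated in $C$ (simultaneous execution); an execution is a maximal sequence of configurations, starting from an arbitrary configuration, each obtained from the previous one by a step. The execution of a rule by a process is a move (e.g. an Update move is an execution of the Update rule). -}

module Defs where

open import Data.Nat using (ℕ; _<_; _≤_)
open import Data.Fin using (Fin)
open import Data.Bool using (Bool; true; false)
open import Data.Maybe using (Maybe; just; nothing)
open import Data.Product using (Σ; ∃; _×_; _,_)
open import Data.Sum using (_⊎_)
open import Data.Unit using (⊤)
open import Relation.Nullary using (¬_)
open import Relation.Binary.PropositionalEquality using (_≡_; _≢_)

record Graph : Set where
  field
    n      : ℕ
    adj    : Fin n → Fin n → Bool
    sym    : ∀ i j → adj i j ≡ true → adj j i ≡ true
    irrefl : ∀ i → adj i i ≡ false
    ident  : Fin n → ℕ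
    ident-distinct :
      ∀ i j → i ≢ j →
      (adj i j ≡ true ⊎ (∃ λ k → adj i k ≡ true × adj k j ≡ true)) →
      ident i ≢ ident j

module Alg (G : Graph) where
  open Graph G

  N : Fin n → Fin n → Set
  N i j = adj i j ≡ true

  _≺_ : Fin n → Fin n → Set
  i ≺ j = ident i < ident j

  _≼_ : Fin n → Fin n → Set
  i ≼ j = ident i ≤ ident j

  -- a configuration: values of m_i and p_i (null = nothing)
  record Config : Set where
    field
      m : Fin n → Bool
      p : Fin n → Maybe (Fin n)
  open Config public

  WellFormed : Config → Set
  WellFormed C = ∀ i j → p C i ≡ just j → N i j

  PRmarried : Config → Fin n → Set
  PRmarried C i = ∃ λ j → N i j × p C i ≡ just j × p C j ≡ just i

  Coherent : Config → Fin n → Set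
  Coherent C i = (m C i ≡ true → PRmarried C i) × (PRmarried C i → m C i ≡ true)

  -- Move C i (b , q): process i, enabled in C, executes a rule whose
  -- effect is to set (m_i , p_i) := (b , q).
  data Move (C : Config) (i : Fin n) : Bool × Maybe (Fin n) → Set where
    update-true  : m C i ≡ false → PRmarried C i →
                   Move C i (true , p C i)
    update-false : m C i ≡ true → ¬ PRmarried C i →
                   Move C i (false , p C i)
    marriage     : (j : Fin n) → Coherent C i → p C i ≡ nothing →
                   N i j → p C j ≡ just i →
                   Move C i (m C i , just j)
    seduction    : (j : Fin n) → Coherent C i → p C i ≡ nothing →
                   (∀ k → N i k → p C k ≢ just i) →
                   N i j → p C j ≡ nothing → i ≺ j → m C j ≡ false →
                   (∀ k → N i k → p C k ≡ nothing → i ≺ k → m C k ≡ false → k ≼ j) →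
                   Move C i (m C i , just j)
    abandonment  : (j : Fin n) → Coherent C i → p C i ≡ just j →
                   p C j ≢ just i → (m C j ≡ true ⊎ j ≼ i) →
                   Move C i (m C i , nothing)

  Eligible : Config → Fin n → Set
  Eligible C i = ∃ λ s → Move C i s

  -- A step of the distributed daemon: the nonempty set S (characteristic
  -- function) of processes move simultaneously, all evaluated in C.
  record Step (C : Config) (S : Fin n → Bool) (C' : Config) : Set where
    field
      nonempty : ∃ λ i → S i ≡ true
      movers   : ∀ i → S i ≡ true → Move C i (m C' i , p C' i)
      others-m : ∀ i → S i ≡ false → m C' i ≡ m C i
      others-p : ∀ i → S i ≡ false → p C' i ≡ p C i

  data Length : Set where
    fin : ℕ → Length
    inf : Length

  _<L_ : ℕ → Length → Set
  t <L fin k = t < k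
  t <L inf   = ⊤

  record Execution : Set where
    field
      cfg      : ℕ → Config
      act      : ℕ → Fin n → Bool
      len      : Length
      init-wf  : WellFormed (cfg 0)
      steps    : ∀ t → t <L len → Step (cfg t) (act t) (cfg (Data.Nat.suc t))
      maximal  : ∀ k → len ≡ fin k → ∀ i → ¬ Eligible (cfg k) i
  open Execution public

module Submission where

open import Defs
open import Data.Nat using (ℕ; _<_; _≤_; _≤′_; ≤′-refl; ≤′-step; suc)
open import Data.Nat.Properties using (≤-<-trans; n≤1+n; ≤⇒≤′)
open import Data.Fin using (Fin)
open import Data.Bool using (true; false)
open import Data.Maybe using (just; nothing)
open import Data.Product using (_×_; _,_; proj₁; proj₂)
open import Data.Unit using (tt)
open import Data.Empty using (⊥; ⊥-elim)
open import Relation.Nullary using (¬_)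
open import Relation.Binary.PropositionalEquality using (_≡_; _≢_; refl; sym; trans; cong)

-- Once i has set m_i := true while married to j, the pair is frozen: i is
-- disabled (Update needs m_i ≠ PRmarried(i), Marriage and Seduction need
-- p_i = null, Abandonment needs p_j ≠ i), and j can at most execute an Update,
-- which leaves p_j = i untouched.  So "m_i = true, p_i = j, p_j = i" persists
-- along the execution, and i never moves again.

module _ (G : Graph) where
  open Graph G using (n)
  open Alg G

  private
    true≢false : true ≢ false
    true≢false ()

    just≢nothing : ∀ {x : Fin n} → just x ≢ nothing
    just≢nothing ()

    mutual-pointer-unabandonable : ∀ C {i j k} → p C i ≡ just j → p C j ≡ just i →
                                   p C i ≡ just k → p C k ≢ just i → ⊥
    mutual-pointer-unabandonable C pi pj pk pk≢i with trans (sym pi) pk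
    ... | refl = pk≢i pj

    unupdated-incoherent : ∀ C {i} → m C i ≡ false → PRmarried C i → ¬ Coherent C i
    unupdated-incoherent C mi married (_ , married⇒mi) = true≢false (trans (sym (married⇒mi married)) mi)

  Married : Config → Fin n → Fin n → Set
  Married C i j = N i j × m C i ≡ true × p C i ≡ just j × p C j ≡ just i

  partnered-move-keeps-p : ∀ {C i j s} → p C i ≡ just j → p C j ≡ just i →
                           Move C i s → proj₂ s ≡ p C i
  partnered-move-keeps-p     pi pj (update-true _ _)                = refl
  partnered-move-keeps-p     pi pj (update-false _ _)               = refl
  partnered-move-keeps-p     pi pj (marriage _ _ pi≡∅ _ _)          = ⊥-elim (just≢nothing (trans (sym pi) pi≡∅))
  partnered-move-keeps-p     pi pj (seduction _ _ pi≡∅ _ _ _ _ _ _) = ⊥-elim (just≢nothing (trans (sym pi) pi≡∅))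
  partnered-move-keeps-p {C} pi pj (abandonment _ _ pk pk≢i _)      = ⊥-elim (mutual-pointer-unabandonable C pi pj pk pk≢i)

  married-ineligible : ∀ {C i j} → Married C i j → ¬ Eligible C i
  married-ineligible     (_ , mi , _ , _)    (_ , update-true mi≡false _)         = true≢false (trans (sym mi) mi≡false)
  married-ineligible     (nij , _ , pi , pj) (_ , update-false _ ¬married)        = ¬married (_ , nij , pi , pj)
  married-ineligible     (_ , _ , pi , _)    (_ , marriage _ _ pi≡∅ _ _)          = just≢nothing (trans (sym pi) pi≡∅)
  married-ineligible     (_ , _ , pi , _)    (_ , seduction _ _ pi≡∅ _ _ _ _ _ _) = just≢nothing (trans (sym pi) pi≡∅)
  married-ineligible {C} (_ , _ , pi , pj)   (_ , abandonment _ _ pk pk≢i _)      = mutual-pointer-unabandonable C pi pj pk pk≢i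

  unupdated-move-is-update : ∀ {C i s} → m C i ≡ false → PRmarried C i →
                             Move C i s → s ≡ (true , p C i)
  unupdated-move-is-update     mi married (update-true _ _)               = refl
  unupdated-move-is-update     mi married (update-false mi′ _)            = ⊥-elim (true≢false (trans (sym mi′) mi))
  unupdated-move-is-update {C} mi married (marriage _ coh _ _ _)          = ⊥-elim (unupdated-incoherent C mi married coh)
  unupdated-move-is-update {C} mi married (seduction _ coh _ _ _ _ _ _ _) = ⊥-elim (unupdated-incoherent C mi married coh)
  unupdated-move-is-update {C} mi married (abandonment _ coh _ _ _)       = ⊥-elim (unupdated-incoherent C mi married coh)

  module _ {C S C′} (step : Step C S C′) where
    open Step step

    ineligible-idle : ∀ {i} → ¬ Eligible C i → S i ≡ false
    ineligible-idle {i} ¬eligible with S i in moved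
    ... | true  = ⊥-elim (¬eligible (_ , movers i moved))
    ... | false = refl

    step-keeps-partner : ∀ {i j} → p C i ≡ just j → p C j ≡ just i → p C′ i ≡ just j
    step-keeps-partner {i} pi pj with S i in moved
    ... | true  = trans (partnered-move-keeps-p pi pj (movers i moved)) pi
    ... | false = trans (others-p i moved) pi

    step-preserves-Married : ∀ {i j} → Married C i j → Married C′ i j
    step-preserves-Married {i} married@(nij , mi , pi , pj) =
      nij , trans (others-m i idle) mi , trans (others-p i idle) pi , step-keeps-partner pj pi
      where idle = ineligible-idle (married-ineligible married)

    update-true-establishes-Married : ∀ {i j} → S i ≡ true → m C i ≡ false →
                                      N i j → p C i ≡ just j → p C j ≡ just i →
                                      Married C′ i j
    update-true-establishes-Married {i} {j} moved mi nij pi pj =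
      nij , cong proj₁ updated , trans (cong proj₂ updated) pi , step-keeps-partner pj pi
      where updated = unupdated-move-is-update mi (j , nij , pi , pj) (movers i moved)

  ≤-<L-trans : ∀ {s t L} → s ≤ t → t <L L → s <L L
  ≤-<L-trans {L = fin _} s≤t t<L = ≤-<-trans s≤t t<L
  ≤-<L-trans {L = inf}   _   _   = tt

  Married-persists : ∀ (E : Execution) {s t i j} → Married (cfg E s) i j →
                     s ≤′ t → t <L len E → Married (cfg E t) i j
  Married-persists E married ≤′-refl                _     = married
  Married-persists E married (≤′-step {t} s≤t) t+1<L =
    step-preserves-Married (steps E t t<L) (Married-persists E married s≤t t<L)
    where t<L = ≤-<L-trans (n≤1+n t) t+1<L

corollary2 : (G : Graph) (E : Alg.Execution G) (t : ℕ) (i : Fin (Graph.n G)) →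
    Alg._<L_ G t (Alg.len E) →
    Alg.act E t i ≡ true →
    Alg.m (Alg.cfg E t) i ≡ false →
    Alg.PRmarried G (Alg.cfg E t) i →
    ∀ t' → t < t' → Alg._<L_ G t' (Alg.len E) →
    Alg.act E t' i ≡ false
corollary2 G E t i t<L moved mi (j , nij , pi , pj) t′ t<t′ t′<L =
  ineligible-idle G (steps E t′ t′<L) (married-ineligible G married-at-t′)
  where
  open Alg G
  married-after-update : Married G (cfg E (suc t)) i j
  married-after-update = update-true-establishes-Married G (steps E t t<L) moved mi nij pi pj
  married-at-t′ : Married G (cfg E t′) i j
  married-at-t′ = Married-persists G E married-after-update (≤⇒≤′ t<t′) t′<L
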